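{- Let $P,Q\in\mathbb{Z}[x]$ be polynomials of degree at most $3$, $\mathcal{F}_k:y^2=P(x)k+Q(x)$, and let $q$ be a prime power with $2\nmid q$. Then $$\#M(\mathbb{F}_q)=q^3+q^2-q\,\#\Delta(\mathbb{F}_q)+q\,\#C(\mathbb{F}_q)+q\Big[\sum_{x\in\mathbb{F}_q,\,P(x)=0}\phi_q(Q(x))\Big]^2.$$ In particular $$\tilde{M}_{2,q}(\mathcal{F}_k)=q\Big(-\#\Delta(\mathbb{F}_q)+\#C(\mathbb{F}_q)+\Big[\sum_{x\in\mathbb{F}_q,\,P(x)=0}\phi_q(Q(x))\Big]^2\Big).$$
   Context: For $q=p^r$ the polynomials are reduced mod $p$. $\phi_q$ is the unique character of order $2$ of $\mathbb{F}_q^\times$, extended by $\phi_q(0)=0$. $\Delta(x_1,x_2)=P(x_1)Q(x_2)-P(x_2)Q(x_1)$, $\Delta(\mathbb{F}_q)=\{(x_1,x_2)\in\mathbb{F}_q^2:\Delta(x_1,x_2)=0\}$, and $C(\mathbb{F}_q)=\{(x_1,x_2,y)\in\mathbb{F}_q^3: P(x_1)P(x_2)=y^2,\ \Delta(x_1,x_2)=0\}$. For $k\in\mathbb{F}_q$, $a_{k,q}=q-\#\{(x,y)\in\mathbb{F}_q^2: y^2=P(x)k+Q(x)\}$, $a_{\infty,q}=q-\#\{(x,y)\in\mathbb{F}_q^2:y^2=P(x)\}$, and $\tilde{M}_{2,q}(\mathcal{F}_k)=\sum_{k\in\mathbb{F}_q}a_{k,q}^2+a_{\infty,q}^2$. Finally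 $\#M(\mathbb{F}_q)=\#\{(x_1,x_2,k,y)\in\mathbb{F}_q^4:(P(x_1)k+Q(x_1))(P(x_2)k+Q(x_2))=y^2\}+\#\{(x_1,x_2,y)\in\mathbb{F}_q^3:P(x_1)P(x_2)=y^2\}$. -}

module Defs where

open import Data.Nat as ℕ using (ℕ; zero; suc)
open import Data.Integer as ℤ using (ℤ; +_; -[1+_])
open import Data.List using (List; length; filter; map; foldr; cartesianProduct)
open import Data.List.Membership.Propositional using (_∈_)
open import Data.List.Relation.Unary.Unique.Propositional using (Unique)
open import Data.List.Relation.Unary.Any using (any?)
open import Data.Bool using (true; false)
open import Data.Vec using (Vec; toList)
open import Data.Product using (_×_; _,_; ∃)
open import Relation.Nullary using (¬_; does)
open import Relation.Nullary.Decidable using (_×-dec_)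
open import Relation.Binary.Definitions using (DecidableEquality)
open import Relation.Binary.PropositionalEquality using (_≡_)
open import Algebra.Structures using (IsCommutativeRing)

record FiniteField : Set₁ where
  field
    Carrier : Set
    _+_ _*_ : Carrier → Carrier → Carrier
    -_ : Carrier → Carrier
    0# 1# : Carrier
    isCommutativeRing : IsCommutativeRing _≡_ _+_ _*_ -_ 0# 1#
    0≢1 : ¬ (0# ≡ 1#)
    inverse : ∀ x → ¬ (x ≡ 0#) → ∃ λ y → x * y ≡ 1#
    _≟_ : DecidableEquality Carrier
    elems : List Carrier
    complete : ∀ x → x ∈ elems
    unique : Unique elems

  order : ℕ
  order = length elems

-- a polynomial of degree at most 3 with integer coefficients,
-- given by its coefficient vector (c₀, c₁, c₂, c₃)
Poly3 : Set
Poly3 = Vec ℤ 4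

sumℤ : List ℤ → ℤ
sumℤ = foldr ℤ._+_ (+ 0)

module _ (F : FiniteField) where
  open FiniteField F

  natF : ℕ → Carrier
  natF zero = 0#
  natF (suc n) = 1# + natF n

  ι : ℤ → Carrier
  ι (+ n) = natF n
  ι -[1+ n ] = - natF (suc n)

  eval : Poly3 → Carrier → Carrier
  eval c x = foldr (λ a acc → ι a + (x * acc)) 0# (toList c)

  φ : Carrier → ℤ
  φ x with does (x ≟ 0#)
  ... | true = + 0
  ... | false with does (any? (λ y → (y * y) ≟ x) elems)
  ...   | true = + 1
  ...   | false = ℤ.- (+ 1)

  pairs : List (Carrier × Carrier)
  pairs = cartesianProduct elems elems

  triples : List (Carrier × Carrier × Carrier)
  triples = cartesianProduct elems pairs

  quads : List (Carrier × Carrier × Carrier × Carrier)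
  quads = cartesianProduct elems triples

  Δ : Poly3 → Poly3 → Carrier → Carrier → Carrier
  Δ P Q x₁ x₂ = (eval P x₁ * eval Q x₂) + (- (eval P x₂ * eval Q x₁))

  #Δ : Poly3 → Poly3 → ℕ
  #Δ P Q = length (filter (λ { (x₁ , x₂) → Δ P Q x₁ x₂ ≟ 0# }) pairs)

  #C : Poly3 → Poly3 → ℕ
  #C P Q = length (filter
    (λ { (x₁ , x₂ , y) → ((eval P x₁ * eval P x₂) ≟ (y * y)) ×-dec (Δ P Q x₁ x₂ ≟ 0#) })
    triples)

  #M : Poly3 → Poly3 → ℕ
  #M P Q =
    length (filter
      (λ { (x₁ , x₂ , k , y) →
        (((eval P x₁ * k) + eval Q x₁) * ((eval P x₂ * k) + eval Q x₂)) ≟ (y * y) })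
      quads)
    ℕ.+ length (filter (λ { (x₁ , x₂ , y) → (eval P x₁ * eval P x₂) ≟ (y * y) }) triples)

  a : Poly3 → Poly3 → Carrier → ℤ
  a P Q k = + order ℤ.- + length (filter
    (λ { (x , y) → (y * y) ≟ ((eval P x * k) + eval Q x) }) pairs)

  a∞ : Poly3 → ℤ
  a∞ P = + order ℤ.- + length (filter (λ { (x , y) → (y * y) ≟ eval P x }) pairs)

  M̃₂ : Poly3 → Poly3 → ℤ
  M̃₂ P Q = sumℤ (map (λ k → a P Q k ℤ.* a P Q k) elems) ℤ.+ (a∞ P ℤ.* a∞ P)

  S : Poly3 → Poly3 → ℤ
  S P Q = sumℤ (map (λ x → φ (eval Q x)) (filter (λ x → eval P x ≟ 0#) elems))

-- Counting square roots, #{y : y² = c} = 1 + φ(c), turns every point count into a character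
-- sum: a_k = -∑ₓ φ(P(x)k + Q(x)), a_∞ = -∑ₓ φ(P(x)), and #M = q³ + q² + M̃₂.  Expanding the
-- squares with the multiplicativity of φ, M̃₂ is the sum over pairs (x₁, x₂) of
-- ∑ₖ φ((p₁k + r₁)(p₂k + r₂)) + φ(p₁p₂), where pᵢ = P(xᵢ), rᵢ = Q(xᵢ).  If p₁ ≠ 0, the
-- substitution u = p₁k + r₁ turns the inner sum into ∑ᵤ φ(u(cu + d)) with φ(c) = φ(p₁p₂) and
-- p₁d = Δ(x₁, x₂); for u ≠ 0 the summand is φ(c + d/u), so the sum is (q[d = 0] - 1)φ(c).
-- If p₁ = 0 it factors as φ(r₁) ∑ₖ φ(p₂k + r₂) = q[p₂ = 0]φ(r₁)φ(r₂).  Hence each pair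
-- contributes q([Δ = 0]φ(p₁p₂) + [p₁ = 0]φ(r₁)[p₂ = 0]φ(r₂)), and summing gives
-- q(#C - #Δ + S²).  Odd order enters only through 1 + 1 ≠ 0, i.e. a nonzero square has two roots.

module Submission where

open import Defs
open import Data.Nat.Divisibility using (_∣_; divides)
open import Data.Integer using (ℤ; +_; _+_; _-_; _*_; -_; _^_)
open import Data.Product using (_×_)
open import Relation.Nullary using (¬_)
open import Relation.Binary.PropositionalEquality using (_≡_)

open import Algebra.Bundles using (CommutativeRing)
open import Algebra.Solver.Ring.AlmostCommutativeRing using (fromCommutativeRing; _-Raw-AlmostCommutative⟶_)
open import Data.Empty using (⊥-elim)
open import Data.Fin as Fin using (Fin)
import Data.Fin.Properties as FinP
open import Data.Integer as ℤ using (-[1+_])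
import Data.Integer.Properties as ℤP
open import Data.Integer.Tactic.RingSolver using (solve-∀)
open import Data.List using (List; []; _∷_; length; filter; map; cartesianProduct; _++_; lookup)
open import Data.List.Membership.Propositional using (_∈_)
open import Data.List.Relation.Unary.All using (All; []; _∷_)
open import Data.List.Relation.Unary.AllPairs using (_∷_)
open import Data.List.Relation.Unary.Any as Any using (Any; here; there)
import Data.List.Relation.Unary.Any.Properties as AnyP
open import Data.List.Relation.Unary.Unique.Propositional using (Unique)
open import Data.Maybe using (Maybe; just; nothing)
open import Data.Nat as ℕ using (zero; suc)
import Data.Nat.Properties as ℕP
open import Data.Product using (_,_; ∃; proj₁; proj₂)
open import Data.Sum using (_⊎_; inj₁; inj₂; [_,_]′)
open import Function using (_∘_; id)
open import Level using (Level)
open import Relation.Binary.Definitions using (DecidableEquality; tri<; tri≈; tri>)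
open import Relation.Binary.PropositionalEquality using (_≢_; refl; sym; trans; cong; cong₂; subst; module ≡-Reasoning)
open import Relation.Nullary using (Dec; yes; no)
open import Relation.Nullary.Decidable using (_×-dec_)
open import Relation.Unary using (Pred; Decidable)
open ≡-Reasoning

-- Finite sums

private variable
  ℓa ℓb ℓ ℓ′ : Level
  A : Set ℓa
  B : Set ℓb

𝟙 : {P : Set ℓ} → Dec P → ℤ
𝟙 (yes _) = + 1
𝟙 (no _)  = + 0

𝟙-yes : {P : Set ℓ} (p : Dec P) → P → 𝟙 p ≡ + 1
𝟙-yes (yes _) _  = refl
𝟙-yes (no ¬p) p = ⊥-elim (¬p p)

𝟙-no : {P : Set ℓ} (p : Dec P) → ¬ P → 𝟙 p ≡ + 0
𝟙-no (yes p) ¬p = ⊥-elim (¬p p)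
𝟙-no (no _)  _  = refl

𝟙-cong : {P : Set ℓ} {Q : Set ℓ′} (p : Dec P) (q : Dec Q) → (P → Q) → (Q → P) → 𝟙 p ≡ 𝟙 q
𝟙-cong (yes _) (yes _) _ _ = refl
𝟙-cong (no _)  (no _)  _ _ = refl
𝟙-cong (yes p) (no ¬q) f _ = ⊥-elim (¬q (f p))
𝟙-cong (no ¬p) (yes q) _ g = ⊥-elim (¬p (g q))

𝟙-× : {P : Set ℓ} {Q : Set ℓ′} (p : Dec P) (q : Dec Q) → 𝟙 (p ×-dec q) ≡ 𝟙 p * 𝟙 q
𝟙-× (yes _) (yes _) = refl
𝟙-× (yes _) (no _)  = refl
𝟙-× (no _)  (yes _) = refl
𝟙-× (no _)  (no _)  = refl

-- Defined through sumℤ so that the sums in Defs are literally of this form.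
∑ : List A → (A → ℤ) → ℤ
∑ xs f = sumℤ (map f xs)

∑-cong : (xs : List A) {f g : A → ℤ} → (∀ x → f x ≡ g x) → ∑ xs f ≡ ∑ xs g
∑-cong []       f≗g = refl
∑-cong (x ∷ xs) f≗g = cong₂ _+_ (f≗g x) (∑-cong xs f≗g)

∑-+ : (xs : List A) (f g : A → ℤ) → ∑ xs (λ x → f x + g x) ≡ ∑ xs f + ∑ xs g
∑-+ []       f g = refl
∑-+ (x ∷ xs) f g = trans (cong (_+_ (f x + g x)) (∑-+ xs f g)) (shuffle (f x) (g x) (∑ xs f) (∑ xs g))
  where shuffle : ∀ u v s t → u + v + (s + t) ≡ u + s + (v + t)
        shuffle = solve-∀

∑-*ˡ : (xs : List A) (c : ℤ) (f : A → ℤ) → ∑ xs (λ x → c * f x) ≡ c * ∑ xs f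
∑-*ˡ []       c f = sym (ℤP.*-zeroʳ c)
∑-*ˡ (x ∷ xs) c f = trans (cong (_+_ (c * f x)) (∑-*ˡ xs c f)) (sym (ℤP.*-distribˡ-+ c (f x) _))

∑-*ʳ : (xs : List A) (c : ℤ) (f : A → ℤ) → ∑ xs (λ x → f x * c) ≡ ∑ xs f * c
∑-*ʳ xs c f = begin
  ∑ xs (λ x → f x * c) ≡⟨ ∑-cong xs (λ x → ℤP.*-comm (f x) c) ⟩
  ∑ xs (λ x → c * f x) ≡⟨ ∑-*ˡ xs c f ⟩
  c * ∑ xs f           ≡⟨ ℤP.*-comm c _ ⟩
  ∑ xs f * c           ∎

∑-neg : (xs : List A) (f : A → ℤ) → ∑ xs (λ x → - f x) ≡ - ∑ xs f
∑-neg []       f = refl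
∑-neg (x ∷ xs) f = trans (cong (_+_ (- f x)) (∑-neg xs f)) (sym (ℤP.neg-distrib-+ (f x) _))

∑-const : (xs : List A) (c : ℤ) → ∑ xs (λ _ → c) ≡ + length xs * c
∑-const []       c = refl
∑-const (x ∷ xs) c = trans (cong (_+_ c) (∑-const xs c)) (sym (ℤP.suc-* (+ length xs) c))

∑-++ : (xs ys : List A) (f : A → ℤ) → ∑ (xs ++ ys) f ≡ ∑ xs f + ∑ ys f
∑-++ []       ys f = sym (ℤP.+-identityˡ _)
∑-++ (x ∷ xs) ys f = trans (cong (_+_ (f x)) (∑-++ xs ys f)) (sym (ℤP.+-assoc (f x) _ _))

∑-map : (g : B → A) (xs : List B) (f : A → ℤ) → ∑ (map g xs) f ≡ ∑ xs (λ x → f (g x))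
∑-map g []       f = refl
∑-map g (x ∷ xs) f = cong (_+_ (f (g x))) (∑-map g xs f)

∑-cartesianProduct : (xs : List A) (ys : List B) (f : A × B → ℤ) →
  ∑ (cartesianProduct xs ys) f ≡ ∑ xs (λ x → ∑ ys (λ y → f (x , y)))
∑-cartesianProduct []       ys f = refl
∑-cartesianProduct (x ∷ xs) ys f = begin
  ∑ (map (x ,_) ys ++ cartesianProduct xs ys) f          ≡⟨ ∑-++ (map (x ,_) ys) _ f ⟩
  ∑ (map (x ,_) ys) f + ∑ (cartesianProduct xs ys) f    ≡⟨ cong₂ _+_ (∑-map (x ,_) ys f) (∑-cartesianProduct xs ys f) ⟩
  ∑ ys (λ y → f (x , y)) + ∑ xs (λ x → ∑ ys (λ y → f (x , y))) ∎

∑-comm : (xs : List A) (ys : List B) (f : A → B → ℤ) →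
  ∑ xs (λ x → ∑ ys (f x)) ≡ ∑ ys (λ y → ∑ xs (λ x → f x y))
∑-comm []       ys f = sym (trans (∑-const ys (+ 0)) (ℤP.*-zeroʳ (+ length ys)))
∑-comm (x ∷ xs) ys f = trans (cong (_+_ (∑ ys (f x))) (∑-comm xs ys f)) (sym (∑-+ ys (f x) _))

∑-*-∑ : (xs : List A) (ys : List B) (f : A → ℤ) (g : B → ℤ) →
  ∑ xs f * ∑ ys g ≡ ∑ xs (λ x → ∑ ys (λ y → f x * g y))
∑-*-∑ xs ys f g = trans (sym (∑-*ʳ xs (∑ ys g) f)) (∑-cong xs (λ x → sym (∑-*ˡ ys (f x) g)))

length-filter : {P : Pred A ℓ} (P? : Decidable P) (xs : List A) →
  + length (filter P? xs) ≡ ∑ xs (λ x → 𝟙 (P? x))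
length-filter P? []       = refl
length-filter P? (x ∷ xs) with P? x
... | yes _ = cong (_+_ (+ 1)) (length-filter P? xs)
... | no _  = trans (length-filter P? xs) (sym (ℤP.+-identityˡ _))

∑-filter : {P : Pred A ℓ} (P? : Decidable P) (xs : List A) (f : A → ℤ) →
  ∑ (filter P? xs) f ≡ ∑ xs (λ x → 𝟙 (P? x) * f x)
∑-filter P? []       f = refl
∑-filter P? (x ∷ xs) f with P? x
... | yes _ = cong₂ _+_ (sym (ℤP.*-identityˡ (f x))) (∑-filter P? xs f)
... | no _  = trans (∑-filter P? xs f) (sym (ℤP.+-identityˡ _))

∑-δ-absent : (_≟_ : DecidableEquality A) {a : A} {xs : List A} → All (a ≢_) xs → (g : A → ℤ) →
  ∑ xs (λ y → 𝟙 (y ≟ a) * g y) ≡ + 0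
∑-δ-absent _≟_ []                   g = refl
∑-δ-absent _≟_ {a} {y ∷ _} (a≢y ∷ a∉xs) g with y ≟ a
... | yes y≡a = ⊥-elim (a≢y (sym y≡a))
... | no _     = trans (ℤP.+-identityˡ _) (∑-δ-absent _≟_ a∉xs g)

∑-δ : (_≟_ : DecidableEquality A) {xs : List A} → Unique xs → ∀ {a} → a ∈ xs → (g : A → ℤ) →
  ∑ xs (λ y → 𝟙 (y ≟ a) * g y) ≡ g a
∑-δ _≟_ {x ∷ xs} (x∉xs ∷ xs-unique) {a} a∈ g with x ≟ a | a∈
... | yes refl | _ = begin
  + 1 * g x + ∑ xs (λ y → 𝟙 (y ≟ x) * g y) ≡⟨ cong₂ _+_ (ℤP.*-identityˡ (g x)) (∑-δ-absent _≟_ x∉xs g) ⟩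
  g x + + 0                                  ≡⟨ ℤP.+-identityʳ (g x) ⟩
  g x                                        ∎
... | no x≢a | here x≡a  = ⊥-elim (x≢a (sym x≡a))
... | no _   | there a∈′ = trans (ℤP.+-identityˡ _) (∑-δ _≟_ xs-unique a∈′ g)

module _ (f : A → ℤ) (f≥0 : ∀ x → ∃ λ n → f x ≡ + n) where

  ∑-nonneg : (xs : List A) → ∃ λ n → ∑ xs f ≡ + n
  ∑-nonneg []       = 0 , refl
  ∑-nonneg (x ∷ xs) with f≥0 x | ∑-nonneg xs
  ... | m , fx≡m | n , ∑≡n = m ℕ.+ n , cong₂ _+_ fx≡m ∑≡n

  ∑-nonneg-≡0 : (xs : List A) → ∑ xs f ≡ + 0 → ∀ {x} → x ∈ xs → f x ≡ + 0
  ∑-nonneg-≡0 (y ∷ ys) ∑≡0 x∈ with f≥0 y | ∑-nonneg ys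
  ... | m , fy≡m | n , ∑≡n with ℤP.+-injective (trans (sym (cong₂ _+_ fy≡m ∑≡n)) ∑≡0) | x∈
  ...   | m+n≡0 | here refl  = trans fy≡m (cong +_ (ℕP.m+n≡0⇒m≡0 m m+n≡0))
  ...   | m+n≡0 | there x∈ys = ∑-nonneg-≡0 ys (trans ∑≡n (cong +_ (ℕP.m+n≡0⇒n≡0 m m+n≡0))) x∈ys

module FiniteFieldTheory (F : FiniteField) where
  open FiniteField F using (Carrier; isCommutativeRing; elems; complete; unique; order; inverse; 0≢1)
    renaming (_≟_ to infix 4 _≟_)

  commutativeRing : CommutativeRing _ _
  commutativeRing = record { isCommutativeRing = isCommutativeRing }

  open CommutativeRing commutativeRing
    using (0#; 1#; +-assoc; +-comm; +-identityˡ; +-identityʳ; -‿inverseˡ; -‿inverseʳ;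
           *-assoc; *-comm; *-identityˡ; *-identityʳ; zeroˡ; zeroʳ; distribʳ; ring)
    renaming (_+_ to _+ᶠ_; _*_ to _·_; -_ to -ᶠ_; _-_ to _-ᶠ_)
  open import Algebra.Properties.Ring ring using (-‿involutive; -‿distribˡ-*; -0#≈0#; -‿+-comm)

  ι-suc : ∀ i → ι F (ℤ.suc i) ≡ 1# +ᶠ ι F i
  ι-suc (+ n)            = refl
  ι-suc -[1+ zero ]      = begin
    0#                    ≡⟨ -‿inverseʳ 1# ⟨
    1# +ᶠ -ᶠ 1#           ≡⟨ cong (λ z → 1# +ᶠ -ᶠ z) (+-identityʳ 1#) ⟨
    1# +ᶠ -ᶠ (1# +ᶠ 0#)   ∎
  ι-suc -[1+ suc n ]     = begin
    -ᶠ x                   ≡⟨ +-identityˡ _ ⟨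
    0# +ᶠ -ᶠ x             ≡⟨ cong (_+ᶠ -ᶠ x) (-‿inverseʳ 1#) ⟨
    1# +ᶠ -ᶠ 1# +ᶠ -ᶠ x    ≡⟨ +-assoc _ _ _ ⟩
    1# +ᶠ (-ᶠ 1# +ᶠ -ᶠ x)  ≡⟨ cong (1# +ᶠ_) (-‿+-comm _ _) ⟩
    1# +ᶠ -ᶠ (1# +ᶠ x)     ∎
    where
      x : Carrier
      x = natF F (suc n)

  ι-pred : ∀ i → ι F (ℤ.pred i) ≡ -ᶠ 1# +ᶠ ι F i
  ι-pred i = begin
    ι F (ℤ.pred i)                    ≡⟨ +-identityˡ _ ⟨
    0# +ᶠ ι F (ℤ.pred i)              ≡⟨ cong (_+ᶠ ι F (ℤ.pred i)) (-‿inverseˡ 1#) ⟨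
    -ᶠ 1# +ᶠ 1# +ᶠ ι F (ℤ.pred i)     ≡⟨ +-assoc _ _ _ ⟩
    -ᶠ 1# +ᶠ (1# +ᶠ ι F (ℤ.pred i))   ≡⟨ cong (-ᶠ 1# +ᶠ_) (ι-suc (ℤ.pred i)) ⟨
    -ᶠ 1# +ᶠ ι F (ℤ.suc (ℤ.pred i))   ≡⟨ cong (λ j → -ᶠ 1# +ᶠ ι F j) (ℤP.suc-pred i) ⟩
    -ᶠ 1# +ᶠ ι F i                    ∎

  ι-+ : ∀ i j → ι F (i + j) ≡ ι F i +ᶠ ι F j
  ι-+ (+ zero)     j = trans (cong (ι F) (ℤP.+-identityˡ j)) (sym (+-identityˡ _))
  ι-+ (+ suc m)    j = begin
    ι F (+ suc m + j)              ≡⟨ cong (ι F) (ℤP.suc-+ m j) ⟩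
    ι F (ℤ.suc (+ m + j))          ≡⟨ ι-suc (+ m + j) ⟩
    1# +ᶠ ι F (+ m + j)            ≡⟨ cong (1# +ᶠ_) (ι-+ (+ m) j) ⟩
    1# +ᶠ (natF F m +ᶠ ι F j)      ≡⟨ +-assoc _ _ _ ⟨
    1# +ᶠ natF F m +ᶠ ι F j        ∎
  ι-+ -[1+ zero ]  j = begin
    ι F (ℤ.pred j)                 ≡⟨ ι-pred j ⟩
    -ᶠ 1# +ᶠ ι F j                 ≡⟨ cong (λ z → -ᶠ z +ᶠ ι F j) (+-identityʳ 1#) ⟨
    -ᶠ (1# +ᶠ 0#) +ᶠ ι F j         ∎
  ι-+ -[1+ suc m ] j = begin
    ι F (-[1+ suc m ] + j)                  ≡⟨ cong (ι F) (ℤP.pred-+ -[1+ m ] j) ⟩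
    ι F (ℤ.pred (-[1+ m ] + j))             ≡⟨ ι-pred (-[1+ m ] + j) ⟩
    -ᶠ 1# +ᶠ ι F (-[1+ m ] + j)             ≡⟨ cong (-ᶠ 1# +ᶠ_) (ι-+ -[1+ m ] j) ⟩
    -ᶠ 1# +ᶠ (-ᶠ natF F (suc m) +ᶠ ι F j)   ≡⟨ +-assoc _ _ _ ⟨
    -ᶠ 1# +ᶠ -ᶠ natF F (suc m) +ᶠ ι F j     ≡⟨ cong (_+ᶠ ι F j) (-‿+-comm _ _) ⟩
    -ᶠ (1# +ᶠ natF F (suc m)) +ᶠ ι F j      ∎

  ι-neg : ∀ i → ι F (- i) ≡ -ᶠ ι F i
  ι-neg (+ zero)  = sym -0#≈0#
  ι-neg (+ suc n) = refl
  ι-neg -[1+ n ]  = sym (-‿involutive _)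

  ι-*⁺ : ∀ m j → ι F (+ m * j) ≡ natF F m · ι F j
  ι-*⁺ zero    j = sym (zeroˡ _)
  ι-*⁺ (suc m) j = begin
    ι F (+ suc m * j)                  ≡⟨ cong (ι F) (ℤP.suc-* (+ m) j) ⟩
    ι F (j + + m * j)                  ≡⟨ ι-+ j (+ m * j) ⟩
    ι F j +ᶠ ι F (+ m * j)             ≡⟨ cong₂ _+ᶠ_ (sym (*-identityˡ _)) (ι-*⁺ m j) ⟩
    1# · ι F j +ᶠ natF F m · ι F j     ≡⟨ distribʳ _ _ _ ⟨
    (1# +ᶠ natF F m) · ι F j           ∎

  ι-* : ∀ i j → ι F (i * j) ≡ ι F i · ι F j
  ι-* (+ m)    j = ι-*⁺ m j
  ι-* -[1+ m ] j = begin
    ι F (-[1+ m ] * j)               ≡⟨ cong (ι F) (ℤP.neg-distribˡ-* (+ suc m) j) ⟨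
    ι F (- (+ suc m * j))            ≡⟨ ι-neg (+ suc m * j) ⟩
    -ᶠ ι F (+ suc m * j)             ≡⟨ cong -ᶠ_ (ι-*⁺ (suc m) j) ⟩
    -ᶠ (natF F (suc m) · ι F j)      ≡⟨ -‿distribˡ-* _ _ ⟩
    -ᶠ natF F (suc m) · ι F j        ∎

  ι-homomorphism : ℤ.+-*-rawRing -Raw-AlmostCommutative⟶ fromCommutativeRing commutativeRing
  ι-homomorphism = record
    { ⟦_⟧ = ι F ; +-homo = ι-+ ; *-homo = ι-* ; -‿homo = ι-neg ; 0-homo = refl ; 1-homo = +-identityʳ 1# }

  ι-≟ : ∀ i j → Maybe (ι F i ≡ ι F j)
  ι-≟ i j with i ℤ.≟ j
  ... | yes i≡j = just (cong (ι F) i≡j)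
  ... | no _    = nothing

  -- Integer coefficients make the solver's normal forms compute, so that it can cancel terms.
  open import Algebra.Solver.Ring ℤ.+-*-rawRing (fromCommutativeRing commutativeRing) ι-homomorphism ι-≟
    using (solve; _:=_; _:+_; _:*_; :-_; _:-_)

  q : ℤ
  q = + order

  ∑F : (Carrier → ℤ) → ℤ
  ∑F = ∑ elems

  ∑F-δ : ∀ a (g : Carrier → ℤ) → ∑F (λ y → 𝟙 (y ≟ a) * g y) ≡ g a
  ∑F-δ a = ∑-δ _≟_ unique (complete a)

  ∑F-𝟙 : ∀ a → ∑F (λ y → 𝟙 (y ≟ a)) ≡ + 1
  ∑F-𝟙 a = trans (∑-cong elems (λ y → sym (ℤP.*-identityʳ _))) (∑F-δ a (λ _ → + 1))

  ∑F-const : ∀ c → ∑F (λ _ → c) ≡ q * c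
  ∑F-const = ∑-const elems

  ∑F-reindex : (σ τ : Carrier → Carrier) → (∀ x → τ (σ x) ≡ x) → (∀ y → σ (τ y) ≡ y) →
    (f : Carrier → ℤ) → ∑F (λ x → f (σ x)) ≡ ∑F f
  ∑F-reindex σ τ τσ≗id στ≗id f = begin
    ∑F (λ x → f (σ x))                          ≡⟨ ∑-cong elems (λ x → sym (∑F-δ (σ x) f)) ⟩
    ∑F (λ x → ∑F (λ y → 𝟙 (y ≟ σ x) * f y))     ≡⟨ ∑-comm elems elems _ ⟩
    ∑F (λ y → ∑F (λ x → 𝟙 (y ≟ σ x) * f y))     ≡⟨ ∑-cong elems (λ y → ∑-cong elems (λ x →
                                                      cong (_* f y) (𝟙-cong (y ≟ σ x) (x ≟ τ y) (y≡σx⇒x≡τy y x) (x≡τy⇒y≡σx y x)))) ⟩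
    ∑F (λ y → ∑F (λ x → 𝟙 (x ≟ τ y) * f y))     ≡⟨ ∑-cong elems (λ y → ∑F-δ (τ y) (λ _ → f y)) ⟩
    ∑F f                                        ∎
    where
      y≡σx⇒x≡τy : ∀ y x → y ≡ σ x → x ≡ τ y
      y≡σx⇒x≡τy y x y≡σx = trans (sym (τσ≗id x)) (cong τ (sym y≡σx))
      x≡τy⇒y≡σx : ∀ y x → x ≡ τ y → y ≡ σ x
      x≡τy⇒y≡σx y x x≡τy = trans (sym (στ≗id y)) (cong σ (sym x≡τy))

  ∑-pairs : (f : Carrier × Carrier → ℤ) → ∑ (pairs F) f ≡ ∑F (λ x → ∑F (λ y → f (x , y)))
  ∑-pairs = ∑-cartesianProduct elems elems

  ∑-triples : (f : Carrier × Carrier × Carrier → ℤ) →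
    ∑ (triples F) f ≡ ∑F (λ x → ∑F (λ y → ∑F (λ z → f (x , y , z))))
  ∑-triples f = trans (∑-cartesianProduct elems (pairs F) f) (∑-cong elems (λ x → ∑-pairs _))

  ∑-quads : (f : Carrier × Carrier × Carrier × Carrier → ℤ) →
    ∑ (quads F) f ≡ ∑F (λ x → ∑F (λ y → ∑F (λ z → ∑F (λ w → f (x , y , z , w)))))
  ∑-quads f = trans (∑-cartesianProduct elems (triples F) f) (∑-cong elems (λ x → ∑-triples _))

  ∑∑ : (Carrier → Carrier → ℤ) → ℤ
  ∑∑ f = ∑F (λ x → ∑F (f x))

  ∑∑-cong : {f g : Carrier → Carrier → ℤ} → (∀ x y → f x y ≡ g x y) → ∑∑ f ≡ ∑∑ g
  ∑∑-cong f≗g = ∑-cong elems (λ x → ∑-cong elems (f≗g x))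

  ∑∑-+ : (f g : Carrier → Carrier → ℤ) → ∑∑ (λ x y → f x y + g x y) ≡ ∑∑ f + ∑∑ g
  ∑∑-+ f g = trans (∑-cong elems (λ x → ∑-+ elems (f x) (g x))) (∑-+ elems _ _)

  ∑∑-*ˡ : (c : ℤ) (f : Carrier → Carrier → ℤ) → ∑∑ (λ x y → c * f x y) ≡ c * ∑∑ f
  ∑∑-*ˡ c f = trans (∑-cong elems (λ x → ∑-*ˡ elems c (f x))) (∑-*ˡ elems c _)

  ∑∑-const : (c : ℤ) → ∑∑ (λ _ _ → c) ≡ q * (q * c)
  ∑∑-const c = trans (∑-cong elems (λ _ → ∑F-const c)) (∑F-const _)

  -- The junk value 0⁻¹ = 0 makes u ↦ d · u⁻¹ an involution of all of F.
  infix 9 _⁻¹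
  _⁻¹ : Carrier → Carrier
  x ⁻¹ with x ≟ 0#
  ... | yes _   = 0#
  ... | no x≢0  = proj₁ (inverse x x≢0)

  0⁻¹≡0 : 0# ⁻¹ ≡ 0#
  0⁻¹≡0 with 0# ≟ 0#
  ... | yes _   = refl
  ... | no 0≢0  = ⊥-elim (0≢0 refl)

  x·x⁻¹≡1 : ∀ {x} → x ≢ 0# → x · x ⁻¹ ≡ 1#
  x·x⁻¹≡1 {x} x≢0 with x ≟ 0#
  ... | yes x≡0 = ⊥-elim (x≢0 x≡0)
  ... | no x≢0′ = proj₂ (inverse x x≢0′)

  x⁻¹·x≡1 : ∀ {x} → x ≢ 0# → x ⁻¹ · x ≡ 1#
  x⁻¹·x≡1 x≢0 = trans (*-comm _ _) (x·x⁻¹≡1 x≢0)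

  x⁻¹·[x·y]≡y : ∀ {x} y → x ≢ 0# → x ⁻¹ · (x · y) ≡ y
  x⁻¹·[x·y]≡y {x} y x≢0 = begin
    x ⁻¹ · (x · y) ≡⟨ *-assoc _ _ _ ⟨
    x ⁻¹ · x · y   ≡⟨ cong (_· y) (x⁻¹·x≡1 x≢0) ⟩
    1# · y         ≡⟨ *-identityˡ y ⟩
    y              ∎

  x·[x⁻¹·y]≡y : ∀ {x} y → x ≢ 0# → x · (x ⁻¹ · y) ≡ y
  x·[x⁻¹·y]≡y {x} y x≢0 = begin
    x · (x ⁻¹ · y) ≡⟨ *-assoc _ _ _ ⟨
    x · x ⁻¹ · y   ≡⟨ cong (_· y) (x·x⁻¹≡1 x≢0) ⟩
    1# · y         ≡⟨ *-identityˡ y ⟩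
    y              ∎

  x·y≡0⇒y≡0 : ∀ {x y} → x · y ≡ 0# → x ≢ 0# → y ≡ 0#
  x·y≡0⇒y≡0 {x} {y} x·y≡0 x≢0 = trans (sym (x⁻¹·[x·y]≡y y x≢0)) (trans (cong (x ⁻¹ ·_) x·y≡0) (zeroʳ _))

  ·-≢0 : ∀ {x y} → x ≢ 0# → y ≢ 0# → x · y ≢ 0#
  ·-≢0 x≢0 y≢0 x·y≡0 = y≢0 (x·y≡0⇒y≡0 x·y≡0 x≢0)

  ⁻¹-unique : ∀ {x y} → x · y ≡ 1# → x ⁻¹ ≡ y
  ⁻¹-unique {x} {y} x·y≡1 = trans (sym (*-identityʳ _)) (trans (cong (x ⁻¹ ·_) (sym x·y≡1)) (x⁻¹·[x·y]≡y y x≢0))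
    where
      x≢0 : x ≢ 0#
      x≢0 x≡0 = 0≢1 (trans (sym (zeroˡ y)) (trans (cong (_· y) (sym x≡0)) x·y≡1))

  -- H picks one element from each orbit {x, σ x}, so the order of the field is 2 · ∑ H.
  fixpoint-free-involution⇒2∣order : (σ : Carrier → Carrier) → (∀ x → σ (σ x) ≡ x) → (∀ x → x ≢ σ x) → 2 ∣ order
  fixpoint-free-involution⇒2∣order σ σ-involutive σ-fixpoint-free = divides ℤ.∣ ∑F H ∣ (begin
    order                ≡⟨ cong ℤ.∣_∣ q≡2∑H ⟩
    ℤ.∣ + 2 * ∑F H ∣     ≡⟨ ℤP.abs-* (+ 2) (∑F H) ⟩
    2 ℕ.* ℤ.∣ ∑F H ∣     ≡⟨ ℕP.*-comm 2 ℤ.∣ ∑F H ∣ ⟩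
    ℤ.∣ ∑F H ∣ ℕ.* 2     ∎)
    where
      position : Carrier → Fin (length elems)
      position x = Any.index (complete x)

      position-injective : ∀ {x y} → position x ≡ position y → x ≡ y
      position-injective {x} {y} eq = trans (AnyP.lookup-index (complete x))
        (trans (cong (lookup elems) eq) (sym (AnyP.lookup-index (complete y))))

      H : Carrier → ℤ
      H x = 𝟙 (position x Fin.<? position (σ x))

      σσ-order : ∀ x → (position (σ x) Fin.< position (σ (σ x))) ≡ (position (σ x) Fin.< position x)
      σσ-order x = cong (λ z → position (σ x) Fin.< position z) (σ-involutive x)

      H+H∘σ≡1 : ∀ x → H x + H (σ x) ≡ + 1
      H+H∘σ≡1 x with position x Fin.<? position (σ x) | position (σ x) Fin.<? position (σ (σ x))
                   | FinP.<-cmp (position x) (position (σ x))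
      ... | yes x<σx | yes σx<σσx | _             = ⊥-elim (FinP.<-asym x<σx (subst id (σσ-order x) σx<σσx))
      ... | yes _    | no _       | _             = refl
      ... | no _     | yes _      | _             = refl
      ... | no x≮σx  | no _       | tri< x<σx _ _ = ⊥-elim (x≮σx x<σx)
      ... | no _     | no _       | tri≈ _ x=σx _ = ⊥-elim (σ-fixpoint-free x (position-injective x=σx))
      ... | no _     | no σx≮σσx  | tri> _ _ σx<x = ⊥-elim (σx≮σσx (subst id (sym (σσ-order x)) σx<x))

      q≡2∑H : q ≡ + 2 * ∑F H
      q≡2∑H = begin
        q                           ≡⟨ ℤP.*-identityʳ q ⟨
        q * + 1                     ≡⟨ ∑F-const (+ 1) ⟨
        ∑F (λ _ → + 1)              ≡⟨ ∑-cong elems (λ x → sym (H+H∘σ≡1 x)) ⟩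
        ∑F (λ x → H x + H (σ x))    ≡⟨ ∑-+ elems H (λ x → H (σ x)) ⟩
        ∑F H + ∑F (λ x → H (σ x))   ≡⟨ cong (_+_ (∑F H)) (∑F-reindex σ σ σ-involutive σ-involutive H) ⟩
        ∑F H + ∑F H                 ≡⟨ s+s≡2*s (∑F H) ⟩
        + 2 * ∑F H                  ∎
        where s+s≡2*s : ∀ s → s + s ≡ + 2 * s
              s+s≡2*s = solve-∀

  1+1≢0 : ¬ 2 ∣ order → 1# +ᶠ 1# ≢ 0#
  1+1≢0 odd 1+1≡0 = odd (fixpoint-free-involution⇒2∣order (_+ᶠ 1#) +1-involutive +1-fixpoint-free)
    where
      +1-involutive : ∀ x → x +ᶠ 1# +ᶠ 1# ≡ x
      +1-involutive x = trans (+-assoc x 1# 1#) (trans (cong (x +ᶠ_) 1+1≡0) (+-identityʳ x))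

      +1-fixpoint-free : ∀ x → x ≢ x +ᶠ 1#
      +1-fixpoint-free x x≡x+1 = 0≢1 (sym (begin
        1#                 ≡⟨ solve 2 (λ x y → y := (:- x :+ x) :+ y) refl x 1# ⟩
        -ᶠ x +ᶠ x +ᶠ 1#    ≡⟨ +-assoc _ _ _ ⟩
        -ᶠ x +ᶠ (x +ᶠ 1#)  ≡⟨ cong (-ᶠ x +ᶠ_) (sym x≡x+1) ⟩
        -ᶠ x +ᶠ x          ≡⟨ -‿inverseˡ x ⟩
        0#                 ∎))

  ∑F-affine : ∀ {p} r → p ≢ 0# → (f : Carrier → ℤ) → ∑F (λ k → f (p · k +ᶠ r)) ≡ ∑F f
  ∑F-affine {p} r p≢0 = ∑F-reindex (λ k → p · k +ᶠ r) (λ u → p ⁻¹ · (u -ᶠ r)) τσ≗id στ≗id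
    where
      τσ≗id : ∀ k → p ⁻¹ · (p · k +ᶠ r -ᶠ r) ≡ k
      τσ≗id k = trans (cong (p ⁻¹ ·_) (solve 3 (λ p k r → p :* k :+ r :- r := p :* k) refl p k r))
                      (x⁻¹·[x·y]≡y k p≢0)
      στ≗id : ∀ u → p · (p ⁻¹ · (u -ᶠ r)) +ᶠ r ≡ u
      στ≗id u = trans (cong (_+ᶠ r) (x·[x⁻¹·y]≡y (u -ᶠ r) p≢0)) (solve 2 (λ u r → u :- r :+ r := u) refl u r)

  -- The quadratic character

  module OddOrder (odd : ¬ 2 ∣ order) where

    IsSquare : Carrier → Set
    IsSquare x = ∃ λ y → y · y ≡ x

    φq : Carrier → ℤ
    φq = φ F

    data Residue (x : Carrier) : Set where
      zero      : x ≡ 0# → φq x ≡ + 0 → Residue x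
      square    : x ≢ 0# → IsSquare x → φq x ≡ + 1 → Residue x
      nonsquare : x ≢ 0# → ¬ IsSquare x → φq x ≡ - + 1 → Residue x

    square⇒root : ∀ {x} → IsSquare x → Any (λ y → y · y ≡ x) elems
    square⇒root {x} (y , y²≡x) = Any.map (λ y≡z → subst (λ w → w · w ≡ x) y≡z y²≡x) (complete y)

    isSquare? : ∀ x → Dec (IsSquare x)
    isSquare? x with Any.any? (λ y → y · y ≟ x) elems
    ... | yes root = yes (Any.satisfied root)
    ... | no ¬root = no (λ sq → ¬root (square⇒root sq))

    φq-0 : ∀ {x} → x ≡ 0# → φq x ≡ + 0
    φq-0 {x} x≡0 with x ≟ 0#
    ... | yes _   = refl
    ... | no x≢0  = ⊥-elim (x≢0 x≡0)

    φq-square : ∀ {x} → x ≢ 0# → IsSquare x → φq x ≡ + 1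
    φq-square {x} x≢0 sq with x ≟ 0#
    ... | yes x≡0 = ⊥-elim (x≢0 x≡0)
    ... | no _ with Any.any? (λ y → y · y ≟ x) elems
    ...   | yes _     = refl
    ...   | no ¬root  = ⊥-elim (¬root (square⇒root sq))

    φq-nonsquare : ∀ {x} → x ≢ 0# → ¬ IsSquare x → φq x ≡ - + 1
    φq-nonsquare {x} x≢0 ¬sq with x ≟ 0#
    ... | yes x≡0 = ⊥-elim (x≢0 x≡0)
    ... | no _ with Any.any? (λ y → y · y ≟ x) elems
    ...   | yes root  = ⊥-elim (¬sq (Any.satisfied root))
    ...   | no _      = refl

    residue : ∀ x → Residue x
    residue x with x ≟ 0# | isSquare? x
    ... | yes x≡0 | _      = zero x≡0 (φq-0 x≡0)
    ... | no x≢0  | yes sq = square x≢0 sq (φq-square x≢0 sq)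
    ... | no x≢0  | no ¬sq = nonsquare x≢0 ¬sq (φq-nonsquare x≢0 ¬sq)

    x≢-x : ∀ {x} → x ≢ 0# → x ≢ -ᶠ x
    x≢-x {x} x≢0 x≡-x = ·-≢0 (1+1≢0 odd) x≢0 (begin
      (1# +ᶠ 1#) · x ≡⟨ trans (distribʳ x 1# 1#) (cong₂ _+ᶠ_ (*-identityˡ x) (*-identityˡ x)) ⟩
      x +ᶠ x         ≡⟨ cong (x +ᶠ_) x≡-x ⟩
      x +ᶠ -ᶠ x      ≡⟨ -‿inverseʳ x ⟩
      0#             ∎)

    square-roots : ∀ {y s} → y · y ≡ s · s → y ≡ s ⊎ y ≡ -ᶠ s
    square-roots {y} {s} y²≡s² with y -ᶠ s ≟ 0#
    ... | yes y-s≡0 = inj₁ (trans (solve 2 (λ y s → y := y :- s :+ s) refl y s)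
                                  (trans (cong (_+ᶠ s) y-s≡0) (+-identityˡ s)))
    ... | no y-s≢0  = inj₂ (trans (solve 2 (λ y s → y := y :+ s :- s) refl y s)
                                  (trans (cong (_-ᶠ s) y+s≡0) (+-identityˡ (-ᶠ s))))
      where
        y+s≡0 : y +ᶠ s ≡ 0#
        y+s≡0 = x·y≡0⇒y≡0 (begin
          (y -ᶠ s) · (y +ᶠ s) ≡⟨ solve 2 (λ y s → (y :- s) :* (y :+ s) := y :* y :- s :* s) refl y s ⟩
          y · y -ᶠ s · s      ≡⟨ cong (_-ᶠ s · s) y²≡s² ⟩
          s · s -ᶠ s · s      ≡⟨ -‿inverseʳ (s · s) ⟩
          0#                  ∎) y-s≢0

    #√ : Carrier → ℤ
    #√ c = ∑F (λ y → 𝟙 (c ≟ y · y))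

    #√≡1+φq : ∀ c → #√ c ≡ + 1 + φq c
    #√≡1+φq c with residue c
    ... | zero c≡0 φc≡0 = begin
      ∑F (λ y → 𝟙 (c ≟ y · y)) ≡⟨ ∑-cong elems (λ y → 𝟙-cong (c ≟ y · y) (y ≟ 0#) (c≡y²⇒y≡0 y) (y≡0⇒c≡y² y)) ⟩
      ∑F (λ y → 𝟙 (y ≟ 0#))    ≡⟨ ∑F-𝟙 0# ⟩
      + 1                      ≡⟨ cong (_+_ (+ 1)) φc≡0 ⟨
      + 1 + φq c               ∎
      where
        c≡y²⇒y≡0 : ∀ y → c ≡ y · y → y ≡ 0#
        c≡y²⇒y≡0 y c≡y² with y ≟ 0#
        ... | yes y≡0 = y≡0
        ... | no y≢0  = x·y≡0⇒y≡0 (trans (sym c≡y²) c≡0) y≢0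
        y≡0⇒c≡y² : ∀ y → y ≡ 0# → c ≡ y · y
        y≡0⇒c≡y² y y≡0 = trans c≡0 (trans (sym (zeroˡ 0#)) (cong₂ _·_ (sym y≡0) (sym y≡0)))
    ... | nonsquare _ ¬sq φc≡-1 = begin
      ∑F (λ y → 𝟙 (c ≟ y · y)) ≡⟨ ∑-cong elems (λ y → 𝟙-no (c ≟ y · y) (λ c≡y² → ¬sq (y , sym c≡y²))) ⟩
      ∑F (λ _ → + 0)           ≡⟨ ∑F-const (+ 0) ⟩
      q * + 0                  ≡⟨ ℤP.*-zeroʳ q ⟩
      + 0                      ≡⟨ cong (_+_ (+ 1)) φc≡-1 ⟨
      + 1 + φq c               ∎
    ... | square c≢0 (s , s²≡c) φc≡1 = begin
      ∑F (λ y → 𝟙 (c ≟ y · y))                     ≡⟨ ∑-cong elems roots ⟩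
      ∑F (λ y → 𝟙 (y ≟ s) + 𝟙 (y ≟ -ᶠ s))          ≡⟨ ∑-+ elems _ _ ⟩
      ∑F (λ y → 𝟙 (y ≟ s)) + ∑F (λ y → 𝟙 (y ≟ -ᶠ s)) ≡⟨ cong₂ _+_ (∑F-𝟙 s) (∑F-𝟙 (-ᶠ s)) ⟩
      + 2                                          ≡⟨ cong (_+_ (+ 1)) φc≡1 ⟨
      + 1 + φq c                                   ∎
      where
        s≢0 : s ≢ 0#
        s≢0 s≡0 = c≢0 (trans (sym s²≡c) (trans (cong (_· s) s≡0) (zeroˡ s)))
        roots : ∀ y → 𝟙 (c ≟ y · y) ≡ 𝟙 (y ≟ s) + 𝟙 (y ≟ -ᶠ s)
        roots y with y ≟ s | y ≟ -ᶠ s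
        ... | yes y≡s | yes y≡-s = ⊥-elim (x≢-x s≢0 (trans (sym y≡s) y≡-s))
        ... | yes y≡s | no _     = 𝟙-yes (c ≟ y · y) (trans (sym s²≡c) (cong₂ _·_ (sym y≡s) (sym y≡s)))
        ... | no _    | yes y≡-s = 𝟙-yes (c ≟ y · y) (trans (sym s²≡c) (trans (solve 1 (λ s → s :* s := (:- s) :* (:- s)) refl s)
                                                                  (cong₂ _·_ (sym y≡-s) (sym y≡-s))))
        ... | no y≢s  | no y≢-s  = 𝟙-no (c ≟ y · y) (λ c≡y² → [ y≢s , y≢-s ]′ (square-roots (trans (sym c≡y²) (sym s²≡c))))

    ∑φq≡0 : ∑F φq ≡ + 0
    ∑φq≡0 = cancel (begin
      q + ∑F φq                ≡⟨ cong (_+ ∑F φq) (trans (sym (ℤP.*-identityʳ q)) (sym (∑F-const (+ 1)))) ⟩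
      ∑F (λ _ → + 1) + ∑F φq   ≡⟨ ∑-+ elems _ φq ⟨
      ∑F (λ c → + 1 + φq c)    ≡⟨ ∑-cong elems #√≡1+φq ⟨
      ∑F #√                    ≡⟨ ∑-comm elems elems _ ⟩
      ∑F (λ y → ∑F (λ c → 𝟙 (c ≟ y · y))) ≡⟨ ∑-cong elems (λ y → ∑F-𝟙 (y · y)) ⟩
      ∑F (λ _ → + 1)           ≡⟨ ∑F-const (+ 1) ⟩
      q * + 1                  ≡⟨ ℤP.*-identityʳ q ⟩
      q                        ∎)
      where
        cancel : ∀ {i j} → i + j ≡ i → j ≡ + 0
        cancel {i} {j} i+j≡i = begin
          j           ≡⟨ j≡i+j-i i j ⟩
          i + j - i   ≡⟨ cong (_- i) i+j≡i ⟩
          i - i       ≡⟨ ℤP.+-inverseʳ i ⟩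
          + 0         ∎
          where j≡i+j-i : ∀ i j → j ≡ i + j - i
                j≡i+j-i = solve-∀

    ∑φq-affine : ∀ {p} r → p ≢ 0# → ∑F (λ k → φq (p · k +ᶠ r)) ≡ + 0
    ∑φq-affine r p≢0 = trans (∑F-affine r p≢0 φq) ∑φq≡0

    ∑φq-translate : ∀ c → ∑F (λ v → φq (c +ᶠ v)) ≡ + 0
    ∑φq-translate c = trans (∑-cong elems (λ v → cong φq (c+v≡1·v+c v))) (∑φq-affine c (λ 1≡0 → 0≢1 (sym 1≡0)))
      where c+v≡1·v+c : ∀ v → c +ᶠ v ≡ 1# · v +ᶠ c
            c+v≡1·v+c v = trans (+-comm c v) (cong (_+ᶠ c) (sym (*-identityˡ v)))

    root≢0 : ∀ {s} → s · s ≢ 0# → s ≢ 0#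
    root≢0 {s} s²≢0 s≡0 = s²≢0 (trans (cong (_· s) s≡0) (zeroˡ s))

    square-cancel : ∀ {s b} → s ≢ 0# → IsSquare (s · s · b) → IsSquare b
    square-cancel {s} {b} s≢0 (u , u²≡s²b) = u · s ⁻¹ , (begin
      u · s ⁻¹ · (u · s ⁻¹)        ≡⟨ solve 2 (λ u i → u :* i :* (u :* i) := u :* u :* (i :* i)) refl u (s ⁻¹) ⟩
      u · u · (s ⁻¹ · s ⁻¹)        ≡⟨ cong (_· (s ⁻¹ · s ⁻¹)) u²≡s²b ⟩
      s · s · b · (s ⁻¹ · s ⁻¹)    ≡⟨ solve 3 (λ s b i → s :* s :* b :* (i :* i) := b :* ((s :* i) :* (s :* i))) refl s b (s ⁻¹) ⟩
      b · (s · s ⁻¹ · (s · s ⁻¹))  ≡⟨ cong (λ z → b · (z · z)) (x·x⁻¹≡1 s≢0) ⟩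
      b · (1# · 1#)                ≡⟨ trans (cong (b ·_) (*-identityˡ 1#)) (*-identityʳ b) ⟩
      b                            ∎)

    module _ {a} (a≢0 : a ≢ 0#) (a-nonsquare : ¬ IsSquare a) where

      a·square-nonsquare : ∀ {s} → s · s ≢ 0# → ¬ IsSquare (a · (s · s))
      a·square-nonsquare {s} s²≢0 sq = a-nonsquare (square-cancel (root≢0 s²≢0) (subst IsSquare (*-comm a (s · s)) sq))

      -- a sends nonzero squares to nonsquares, so φ x + φ (a x) ≤ 0 everywhere; its sum over F is 0,
      -- so it vanishes at each nonsquare x, which forces φ (a x) = 1.
      -[φq+φq∘a·]≥0 : ∀ x → ∃ λ n → - (φq x + φq (a · x)) ≡ + n
      -[φq+φq∘a·]≥0 x with residue x
      ... | zero x≡0 φx≡0 rewrite φx≡0 | φq-0 (trans (cong (a ·_) x≡0) (zeroʳ a)) = 0 , refl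
      ... | square x≢0 (s , refl) φx≡1 rewrite φx≡1 | φq-nonsquare (·-≢0 a≢0 x≢0) (a·square-nonsquare x≢0) = 0 , refl
      ... | nonsquare _ _ φx≡-1 with residue (a · x)
      ...   | zero _ φax≡0          rewrite φx≡-1 | φax≡0  = 1 , refl
      ...   | square _ _ φax≡1      rewrite φx≡-1 | φax≡1  = 0 , refl
      ...   | nonsquare _ _ φax≡-1  rewrite φx≡-1 | φax≡-1 = 2 , refl

      ∑-[φq+φq∘a·]≡0 : ∑F (λ x → - (φq x + φq (a · x))) ≡ + 0
      ∑-[φq+φq∘a·]≡0 = begin
        ∑F (λ x → - (φq x + φq (a · x)))    ≡⟨ ∑-neg elems _ ⟩
        - ∑F (λ x → φq x + φq (a · x))      ≡⟨ cong -_ (∑-+ elems φq _) ⟩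
        - (∑F φq + ∑F (λ x → φq (a · x)))   ≡⟨ cong (λ s → - (∑F φq + s)) ∑φq-scaled ⟩
        - (∑F φq + + 0)                     ≡⟨ cong (λ s → - (s + + 0)) ∑φq≡0 ⟩
        + 0                                 ∎
        where ∑φq-scaled : ∑F (λ x → φq (a · x)) ≡ + 0
              ∑φq-scaled = trans (∑-cong elems (λ x → cong φq (sym (+-identityʳ (a · x))))) (∑φq-affine 0# a≢0)

      φq-nonsquare·nonsquare : ∀ {b} → b ≢ 0# → ¬ IsSquare b → φq (a · b) ≡ + 1
      φq-nonsquare·nonsquare {b} b≢0 ¬sq = begin
        φq (a · b)                          ≡⟨ j≡--[i+j]-i (φq b) (φq (a · b)) ⟩
        - - (φq b + φq (a · b)) - φq b      ≡⟨ cong₂ (λ t i → - t - i) term≡0 (φq-nonsquare b≢0 ¬sq) ⟩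
        - + 0 - - + 1                       ≡⟨⟩
        + 1                                 ∎
        where
          term≡0 : - (φq b + φq (a · b)) ≡ + 0
          term≡0 = ∑-nonneg-≡0 _ -[φq+φq∘a·]≥0 elems ∑-[φq+φq∘a·]≡0 (complete b)
          j≡--[i+j]-i : ∀ i j → j ≡ - - (i + j) - i
          j≡--[i+j]-i = solve-∀

    φq-* : ∀ x y → φq (x · y) ≡ φq x * φq y
    φq-* x y with residue x | residue y
    ... | zero refl φx | _ rewrite φx = φq-0 (zeroˡ y)
    ... | square _ _ φx | zero refl φy rewrite φx | φy = φq-0 (zeroʳ x)
    ... | nonsquare _ _ φx | zero refl φy rewrite φx | φy = φq-0 (zeroʳ x)
    ... | square x≢0 (s , refl) φx | square y≢0 (t , refl) φy rewrite φx | φy =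
      φq-square (·-≢0 x≢0 y≢0) (s · t , solve 2 (λ s t → s :* t :* (s :* t) := s :* s :* (t :* t)) refl s t)
    ... | square x≢0 (s , refl) φx | nonsquare y≢0 ¬sq φy rewrite φx | φy =
      φq-nonsquare (·-≢0 x≢0 y≢0) (λ sq → ¬sq (square-cancel (root≢0 x≢0) sq))
    ... | nonsquare x≢0 ¬sq φx | square y≢0 (t , refl) φy rewrite φx | φy =
      φq-nonsquare (·-≢0 x≢0 y≢0) (λ sq → ¬sq (square-cancel (root≢0 y≢0) (subst IsSquare (*-comm x (t · t)) sq)))
    ... | nonsquare x≢0 ¬sqx φx | nonsquare y≢0 ¬sqy φy rewrite φx | φy =
      φq-nonsquare·nonsquare x≢0 ¬sqx y≢0 ¬sqy

    φq[u·u·w]≡φq[w] : ∀ {u} w → u ≢ 0# → φq (u · u · w) ≡ φq w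
    φq[u·u·w]≡φq[w] {u} w u≢0 = begin
      φq (u · u · w)            ≡⟨ φq-* (u · u) w ⟩
      φq (u · u) * φq w         ≡⟨ cong (_* φq w) (φq-square (·-≢0 u≢0 u≢0) (u , refl)) ⟩
      + 1 * φq w                ≡⟨ ℤP.*-identityˡ (φq w) ⟩
      φq w                      ∎

    -- Character sums

    ∑φq[c+d/u] : ∀ c d → ∑F (λ u → φq (c +ᶠ d · u ⁻¹)) ≡ q * 𝟙 (d ≟ 0#) * φq c
    ∑φq[c+d/u] c d with d ≟ 0#
    ... | yes refl = begin
      ∑F (λ u → φq (c +ᶠ 0# · u ⁻¹))  ≡⟨ ∑-cong elems (λ u → cong φq (trans (cong (c +ᶠ_) (zeroˡ (u ⁻¹))) (+-identityʳ c))) ⟩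
      ∑F (λ _ → φq c)                 ≡⟨ ∑F-const (φq c) ⟩
      q * φq c                        ≡⟨ cong (_* φq c) (ℤP.*-identityʳ q) ⟨
      q * + 1 * φq c                  ∎
    ... | no d≢0 = begin
      ∑F (λ u → φq (c +ᶠ σ u))        ≡⟨ ∑F-reindex σ σ σ-involutive σ-involutive (λ v → φq (c +ᶠ v)) ⟩
      ∑F (λ v → φq (c +ᶠ v))          ≡⟨ ∑φq-translate c ⟩
      + 0                             ≡⟨ cong (_* φq c) (ℤP.*-zeroʳ q) ⟨
      q * + 0 * φq c                  ∎
      where
        σ : Carrier → Carrier
        σ u = d · u ⁻¹

        σ0≡0 : σ 0# ≡ 0#
        σ0≡0 = trans (cong (d ·_) 0⁻¹≡0) (zeroʳ d)

        σ-involutive : ∀ u → σ (σ u) ≡ u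
        σ-involutive u = by-cases (u ≟ 0#)
          where
            by-cases : Dec (u ≡ 0#) → σ (σ u) ≡ u
            by-cases (yes u≡0) = begin
              σ (σ u)    ≡⟨ cong (λ z → σ (σ z)) u≡0 ⟩
              σ (σ 0#)   ≡⟨ trans (cong σ σ0≡0) σ0≡0 ⟩
              0#         ≡⟨ u≡0 ⟨
              u          ∎
            by-cases (no u≢0) = begin
              d · (d · u ⁻¹) ⁻¹    ≡⟨ cong (d ·_) (⁻¹-unique (begin
                  d · u ⁻¹ · (u · d ⁻¹)    ≡⟨ solve 4 (λ d i u j → d :* i :* (u :* j) := d :* j :* (u :* i)) refl d (u ⁻¹) u (d ⁻¹) ⟩
                  d · d ⁻¹ · (u · u ⁻¹)    ≡⟨ cong₂ _·_ (x·x⁻¹≡1 d≢0) (x·x⁻¹≡1 u≢0) ⟩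
                  1# · 1#                  ≡⟨ *-identityˡ 1# ⟩
                  1#                       ∎)) ⟩
              d · (u · d ⁻¹)       ≡⟨ cong (d ·_) (*-comm u (d ⁻¹)) ⟩
              d · (d ⁻¹ · u)       ≡⟨ x·[x⁻¹·y]≡y u d≢0 ⟩
              u                    ∎

    ∑φq-quadratic : ∀ c d → ∑F (λ u → φq (u · (c · u +ᶠ d))) ≡ (q * 𝟙 (d ≟ 0#) - + 1) * φq c
    ∑φq-quadratic c d = begin
      ∑F (λ u → φq (u · (c · u +ᶠ d)))                                    ≡⟨ ∑-cong elems term ⟩
      ∑F (λ u → φq (c +ᶠ d · u ⁻¹) + - (𝟙 (u ≟ 0#) * φq c))                ≡⟨ ∑-+ elems _ _ ⟩
      ∑F (λ u → φq (c +ᶠ d · u ⁻¹)) + ∑F (λ u → - (𝟙 (u ≟ 0#) * φq c))    ≡⟨ cong₂ _+_ (∑φq[c+d/u] c d)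
                                                                              (trans (∑-neg elems _) (cong -_ (∑F-δ 0# (λ _ → φq c)))) ⟩
      q * 𝟙 (d ≟ 0#) * φq c + - φq c                                       ≡⟨ xy-y≡[x-1]y (q * 𝟙 (d ≟ 0#)) (φq c) ⟩
      (q * 𝟙 (d ≟ 0#) - + 1) * φq c                                        ∎
      where
        xy-y≡[x-1]y : ∀ x y → x * y + - y ≡ (x - + 1) * y
        xy-y≡[x-1]y = solve-∀
        term : ∀ u → φq (u · (c · u +ᶠ d)) ≡ φq (c +ᶠ d · u ⁻¹) + - (𝟙 (u ≟ 0#) * φq c)
        term u = by-cases (u ≟ 0#)
          where
          by-cases : Dec (u ≡ 0#) → φq (u · (c · u +ᶠ d)) ≡ φq (c +ᶠ d · u ⁻¹) + - (𝟙 (u ≟ 0#) * φq c)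
          by-cases (yes u≡0) = begin
            φq (u · (c · u +ᶠ d))                  ≡⟨ φq-0 (trans (cong (_· (c · u +ᶠ d)) u≡0) (zeroˡ _)) ⟩
            + 0                                    ≡⟨ x-1*x≡0 (φq c) ⟨
            φq c + - (+ 1 * φq c)                  ≡⟨ cong₂ (λ z i → φq z + - (i * φq c)) c≡c+d/u (sym (𝟙-yes (u ≟ 0#) u≡0)) ⟩
            φq (c +ᶠ d · u ⁻¹) + - (𝟙 (u ≟ 0#) * φq c)   ∎
            where
              x-1*x≡0 : ∀ x → x + - (+ 1 * x) ≡ + 0
              x-1*x≡0 = solve-∀
              c≡c+d/u : c ≡ c +ᶠ d · u ⁻¹
              c≡c+d/u = sym (begin
                c +ᶠ d · u ⁻¹     ≡⟨ cong (λ z → c +ᶠ d · z ⁻¹) u≡0 ⟩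
                c +ᶠ d · 0# ⁻¹    ≡⟨ cong (λ z → c +ᶠ d · z) 0⁻¹≡0 ⟩
                c +ᶠ d · 0#       ≡⟨ cong (c +ᶠ_) (zeroʳ d) ⟩
                c +ᶠ 0#           ≡⟨ +-identityʳ c ⟩
                c                 ∎)
          by-cases (no u≢0) = begin
            φq (u · (c · u +ᶠ d))                  ≡⟨ cong φq u·[cu+d]≡u²·[c+d/u] ⟩
            φq (u · u · (c +ᶠ d · u ⁻¹))           ≡⟨ φq[u·u·w]≡φq[w] _ u≢0 ⟩
            φq (c +ᶠ d · u ⁻¹)                     ≡⟨ ℤP.+-identityʳ _ ⟨
            φq (c +ᶠ d · u ⁻¹) + - (+ 0 * φq c)    ≡⟨ cong (λ i → φq (c +ᶠ d · u ⁻¹) + - (i * φq c)) (𝟙-no (u ≟ 0#) u≢0) ⟨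
            φq (c +ᶠ d · u ⁻¹) + - (𝟙 (u ≟ 0#) * φq c)   ∎
            where
              u·[cu+d]≡u²·[c+d/u] : u · (c · u +ᶠ d) ≡ u · u · (c +ᶠ d · u ⁻¹)
              u·[cu+d]≡u²·[c+d/u] = begin
                u · (c · u +ᶠ d)                   ≡⟨ cong (λ z → u · (c · u +ᶠ z)) (*-identityʳ d) ⟨
                u · (c · u +ᶠ d · 1#)              ≡⟨ cong (λ z → u · (c · u +ᶠ d · z)) (x·x⁻¹≡1 u≢0) ⟨
                u · (c · u +ᶠ d · (u · u ⁻¹))      ≡⟨ solve 4 (λ u c d i → u :* (c :* u :+ d :* (u :* i)) := u :* u :* (c :+ d :* i)) refl u c d (u ⁻¹) ⟩
                u · u · (c +ᶠ d · u ⁻¹)            ∎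

    ∑φq-linear : ∀ p r → ∑F (λ k → φq (p · k +ᶠ r)) ≡ q * (𝟙 (p ≟ 0#) * φq r)
    ∑φq-linear p r with p ≟ 0#
    ... | yes refl = begin
      ∑F (λ k → φq (0# · k +ᶠ r))   ≡⟨ ∑-cong elems (λ k → cong φq (trans (cong (_+ᶠ r) (zeroˡ k)) (+-identityˡ r))) ⟩
      ∑F (λ _ → φq r)               ≡⟨ ∑F-const (φq r) ⟩
      q * φq r                      ≡⟨ cong (q *_) (ℤP.*-identityˡ (φq r)) ⟨
      q * (+ 1 * φq r)              ∎
    ... | no p≢0 = trans (∑φq-affine r p≢0) (sym (ℤP.*-zeroʳ q))

    ∑φq-product-generic : ∀ {p₁} r₁ p₂ r₂ → p₁ ≢ 0# →
      ∑F (λ k → φq ((p₁ · k +ᶠ r₁) · (p₂ · k +ᶠ r₂)))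
        ≡ (q * 𝟙 (p₁ · r₂ -ᶠ p₂ · r₁ ≟ 0#) - + 1) * φq (p₁ · p₂)
    ∑φq-product-generic {p₁} r₁ p₂ r₂ p₁≢0 = begin
      ∑F (λ k → φq ((p₁ · k +ᶠ r₁) · (p₂ · k +ᶠ r₂)))             ≡⟨ ∑-cong elems (λ k → cong (λ z → φq ((p₁ · k +ᶠ r₁) · z)) (line k)) ⟨
      ∑F (λ k → φq ((p₁ · k +ᶠ r₁) · (c · (p₁ · k +ᶠ r₁) +ᶠ d)))  ≡⟨ ∑F-affine r₁ p₁≢0 (λ u → φq (u · (c · u +ᶠ d))) ⟩
      ∑F (λ u → φq (u · (c · u +ᶠ d)))                            ≡⟨ ∑φq-quadratic c d ⟩
      (q * 𝟙 (d ≟ 0#) - + 1) * φq c                               ≡⟨ cong₂ (λ i z → (q * i - + 1) * z)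
                                                                        (𝟙-cong (d ≟ 0#) (det ≟ 0#) d≡0⇒det≡0 det≡0⇒d≡0) (sym φq[p₁p₂]≡φq[c]) ⟩
      (q * 𝟙 (det ≟ 0#) - + 1) * φq (p₁ · p₂)                       ∎
      where
        det c d : Carrier
        det = p₁ · r₂ -ᶠ p₂ · r₁
        c = p₂ · p₁ ⁻¹
        d = r₂ -ᶠ c · r₁

        line : ∀ k → c · (p₁ · k +ᶠ r₁) +ᶠ d ≡ p₂ · k +ᶠ r₂
        line k = begin
          c · (p₁ · k +ᶠ r₁) +ᶠ d       ≡⟨ solve 6 (λ p₂ i p₁ k r₁ r₂ → p₂ :* i :* (p₁ :* k :+ r₁) :+ (r₂ :- p₂ :* i :* r₁)
                                                                         := p₂ :* (i :* p₁) :* k :+ r₂) refl p₂ (p₁ ⁻¹) p₁ k r₁ r₂ ⟩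
          p₂ · (p₁ ⁻¹ · p₁) · k +ᶠ r₂   ≡⟨ cong (λ z → p₂ · z · k +ᶠ r₂) (x⁻¹·x≡1 p₁≢0) ⟩
          p₂ · 1# · k +ᶠ r₂             ≡⟨ cong (λ z → z · k +ᶠ r₂) (*-identityʳ p₂) ⟩
          p₂ · k +ᶠ r₂                  ∎

        p₁·d≡det : p₁ · d ≡ det
        p₁·d≡det = begin
          p₁ · (r₂ -ᶠ p₂ · p₁ ⁻¹ · r₁)         ≡⟨ solve 5 (λ p₁ r₂ p₂ i r₁ → p₁ :* (r₂ :- p₂ :* i :* r₁)
                                                                         := p₁ :* r₂ :- p₂ :* (p₁ :* i) :* r₁) refl p₁ r₂ p₂ (p₁ ⁻¹) r₁ ⟩
          p₁ · r₂ -ᶠ p₂ · (p₁ · p₁ ⁻¹) · r₁    ≡⟨ cong (λ z → p₁ · r₂ -ᶠ p₂ · z · r₁) (x·x⁻¹≡1 p₁≢0) ⟩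
          p₁ · r₂ -ᶠ p₂ · 1# · r₁              ≡⟨ cong (λ z → p₁ · r₂ -ᶠ z · r₁) (*-identityʳ p₂) ⟩
          det                                    ∎

        d≡0⇒det≡0 : d ≡ 0# → det ≡ 0#
        d≡0⇒det≡0 d≡0 = trans (sym p₁·d≡det) (trans (cong (p₁ ·_) d≡0) (zeroʳ p₁))

        det≡0⇒d≡0 : det ≡ 0# → d ≡ 0#
        det≡0⇒d≡0 det≡0 = x·y≡0⇒y≡0 (trans p₁·d≡det det≡0) p₁≢0

        φq[p₁p₂]≡φq[c] : φq (p₁ · p₂) ≡ φq c
        φq[p₁p₂]≡φq[c] = trans (cong φq (begin
          p₁ · p₂                   ≡⟨ *-identityʳ _ ⟨
          p₁ · p₂ · 1#              ≡⟨ cong (p₁ · p₂ ·_) (x·x⁻¹≡1 p₁≢0) ⟨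
          p₁ · p₂ · (p₁ · p₁ ⁻¹)    ≡⟨ solve 3 (λ p₁ p₂ i → p₁ :* p₂ :* (p₁ :* i) := p₁ :* p₁ :* (p₂ :* i)) refl p₁ p₂ (p₁ ⁻¹) ⟩
          p₁ · p₁ · c               ∎)) (φq[u·u·w]≡φq[w] c p₁≢0)

    ∑φq-product : ∀ p₁ r₁ p₂ r₂ →
      ∑F (λ k → φq ((p₁ · k +ᶠ r₁) · (p₂ · k +ᶠ r₂))) + φq (p₁ · p₂)
        ≡ q * (𝟙 (p₁ · r₂ -ᶠ p₂ · r₁ ≟ 0#) * φq (p₁ · p₂) + 𝟙 (p₁ ≟ 0#) * φq r₁ * (𝟙 (p₂ ≟ 0#) * φq r₂))
    ∑φq-product p₁ r₁ p₂ r₂ with p₁ ≟ 0#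
    ... | no p₁≢0 = trans (cong (_+ φq (p₁ · p₂)) (∑φq-product-generic r₁ p₂ r₂ p₁≢0))
                          ([qD-1]f+f≡q[Df+0] q _ (φq (p₁ · p₂)) (φq r₁) (𝟙 (p₂ ≟ 0#) * φq r₂))
      where [qD-1]f+f≡q[Df+0] : ∀ q D f x y → (q * D - + 1) * f + f ≡ q * (D * f + + 0 * x * y)
            [qD-1]f+f≡q[Df+0] = solve-∀
    ... | yes refl = begin
      ∑F (λ k → φq ((0# · k +ᶠ r₁) · (p₂ · k +ᶠ r₂))) + φq (0# · p₂)  ≡⟨ cong₂ _+_ factor (φq-0 (zeroˡ p₂)) ⟩
      φq r₁ * (q * (𝟙 (p₂ ≟ 0#) * φq r₂)) + + 0                       ≡⟨ x[qy]+0≡q[D0+xy] q (𝟙 (det ≟ 0#)) (φq r₁) _ ⟩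
      q * (𝟙 (det ≟ 0#) * + 0 + + 1 * φq r₁ * (𝟙 (p₂ ≟ 0#) * φq r₂))    ≡⟨ cong (λ z → q * (𝟙 (det ≟ 0#) * z + + 1 * φq r₁ * (𝟙 (p₂ ≟ 0#) * φq r₂)))
                                                                             (φq-0 (zeroˡ p₂)) ⟨
      q * (𝟙 (det ≟ 0#) * φq (0# · p₂) + + 1 * φq r₁ * (𝟙 (p₂ ≟ 0#) * φq r₂)) ∎
      where
        det : Carrier
        det = 0# · r₂ -ᶠ p₂ · r₁
        x[qy]+0≡q[D0+xy] : ∀ q D x y → x * (q * y) + + 0 ≡ q * (D * + 0 + + 1 * x * y)
        x[qy]+0≡q[D0+xy] = solve-∀
        factor : ∑F (λ k → φq ((0# · k +ᶠ r₁) · (p₂ · k +ᶠ r₂))) ≡ φq r₁ * (q * (𝟙 (p₂ ≟ 0#) * φq r₂))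
        factor = begin
          ∑F (λ k → φq ((0# · k +ᶠ r₁) · (p₂ · k +ᶠ r₂)))  ≡⟨ ∑-cong elems (λ k → trans (cong (λ z → φq (z · (p₂ · k +ᶠ r₂)))
                                                                (trans (cong (_+ᶠ r₁) (zeroˡ k)) (+-identityˡ r₁))) (φq-* r₁ _)) ⟩
          ∑F (λ k → φq r₁ * φq (p₂ · k +ᶠ r₂))             ≡⟨ ∑-*ˡ elems (φq r₁) _ ⟩
          φq r₁ * ∑F (λ k → φq (p₂ · k +ᶠ r₂))             ≡⟨ cong (φq r₁ *_) (∑φq-linear p₂ r₂) ⟩
          φq r₁ * (q * (𝟙 (p₂ ≟ 0#) * φq r₂))              ∎

    -- Point counts

    q-#[y²≡f]≡-∑φq : (f : Carrier → Carrier) → q - ∑F (λ x → ∑F (λ y → 𝟙 (y · y ≟ f x))) ≡ - ∑F (λ x → φq (f x))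
    q-#[y²≡f]≡-∑φq f = begin
      q - ∑F (λ x → ∑F (λ y → 𝟙 (y · y ≟ f x)))  ≡⟨ cong (_-_ q) (∑-cong elems (λ x → ∑-cong elems (λ y → 𝟙-cong (y · y ≟ f x) (f x ≟ y · y) sym sym))) ⟩
      q - ∑F (λ x → #√ (f x))                    ≡⟨ cong (_-_ q) (∑-cong elems (λ x → #√≡1+φq (f x))) ⟩
      q - ∑F (λ x → + 1 + φq (f x))              ≡⟨ cong (_-_ q) (∑-+ elems _ _) ⟩
      q - (∑F (λ _ → + 1) + ∑F (λ x → φq (f x))) ≡⟨ cong (λ n → q - (n + ∑F (λ x → φq (f x)))) (∑F-const (+ 1)) ⟩
      q - (q * + 1 + ∑F (λ x → φq (f x)))        ≡⟨ q-[q*1+s]≡-s q _ ⟩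
      - ∑F (λ x → φq (f x))                      ∎
      where q-[q*1+s]≡-s : ∀ q s → q - (q * + 1 + s) ≡ - s
            q-[q*1+s]≡-s = solve-∀

    [-∑φq]²≡∑∑φq : (f : Carrier → Carrier) →
      - ∑F (λ x → φq (f x)) * - ∑F (λ x → φq (f x)) ≡ ∑∑ (λ x₁ x₂ → φq (f x₁ · f x₂))
    [-∑φq]²≡∑∑φq f = begin
      - ∑F (φq ∘ f) * - ∑F (φq ∘ f)                    ≡⟨ -t*-t≡t*t (∑F (φq ∘ f)) ⟩
      ∑F (φq ∘ f) * ∑F (φq ∘ f)                        ≡⟨ ∑-*-∑ elems elems (φq ∘ f) (φq ∘ f) ⟩
      ∑∑ (λ x₁ x₂ → φq (f x₁) * φq (f x₂))             ≡⟨ ∑∑-cong (λ x₁ x₂ → φq-* (f x₁) (f x₂)) ⟨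
      ∑∑ (λ x₁ x₂ → φq (f x₁ · f x₂))                  ∎
      where -t*-t≡t*t : ∀ t → - t * - t ≡ t * t
            -t*-t≡t*t = solve-∀

    module Counts (P Q : Poly3) where
      P̂ Q̂ : Carrier → Carrier
      P̂ = eval F P
      Q̂ = eval F Q

      𝟙Δ : Carrier → Carrier → ℤ
      𝟙Δ x₁ x₂ = 𝟙 (Δ F P Q x₁ x₂ ≟ 0#)

      moment : ℤ
      moment = ∑∑ (λ x₁ x₂ → ∑F (λ k → φq ((P̂ x₁ · k +ᶠ Q̂ x₁) · (P̂ x₂ · k +ᶠ Q̂ x₂))) + φq (P̂ x₁ · P̂ x₂))

      #M≡q³+q²+moment : + #M F P Q ≡ q ^ 3 + q ^ 2 + moment
      #M≡q³+q²+moment = begin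
        + #M F P Q
          ≡⟨ trans (ℤP.pos-+ (length (filter _ (quads F))) (length (filter _ (triples F))))
                   (cong₂ _+_ (trans (length-filter _ (quads F)) (∑-quads _)) (trans (length-filter _ (triples F)) (∑-triples _))) ⟩
        ∑∑ (λ x₁ x₂ → ∑F (λ k → #√ ((P̂ x₁ · k +ᶠ Q̂ x₁) · (P̂ x₂ · k +ᶠ Q̂ x₂)))) + ∑∑ (λ x₁ x₂ → #√ (P̂ x₁ · P̂ x₂))
          ≡⟨ ∑∑-+ _ _ ⟨
        ∑∑ (λ x₁ x₂ → ∑F (λ k → #√ ((P̂ x₁ · k +ᶠ Q̂ x₁) · (P̂ x₂ · k +ᶠ Q̂ x₂))) + #√ (P̂ x₁ · P̂ x₂))
          ≡⟨ ∑∑-cong term ⟩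
        ∑∑ (λ x₁ x₂ → q + + 1 + G x₁ x₂)
          ≡⟨ ∑∑-+ _ _ ⟩
        ∑∑ (λ _ _ → q + + 1) + moment
          ≡⟨ cong (_+ moment) (trans (∑∑-const (q + + 1)) (q[q[q+1]]≡q³+q² q)) ⟩
        q ^ 3 + q ^ 2 + moment
          ∎
        where
          G : Carrier → Carrier → ℤ
          G x₁ x₂ = ∑F (λ k → φq ((P̂ x₁ · k +ᶠ Q̂ x₁) · (P̂ x₂ · k +ᶠ Q̂ x₂))) + φq (P̂ x₁ · P̂ x₂)
          term : ∀ x₁ x₂ → ∑F (λ k → #√ ((P̂ x₁ · k +ᶠ Q̂ x₁) · (P̂ x₂ · k +ᶠ Q̂ x₂))) + #√ (P̂ x₁ · P̂ x₂) ≡ q + + 1 + G x₁ x₂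
          term x₁ x₂ = begin
            ∑F (λ k → #√ (L k)) + #√ (P̂ x₁ · P̂ x₂)                   ≡⟨ cong₂ _+_ (∑-cong elems (λ k → #√≡1+φq (L k))) (#√≡1+φq _) ⟩
            ∑F (λ k → + 1 + φq (L k)) + (+ 1 + φq (P̂ x₁ · P̂ x₂))    ≡⟨ cong (_+ (+ 1 + φq (P̂ x₁ · P̂ x₂))) (∑-+ elems _ _) ⟩
            ∑F (λ _ → + 1) + ∑F (λ k → φq (L k)) + (+ 1 + φq (P̂ x₁ · P̂ x₂))
                                                                        ≡⟨ cong (λ n → n + ∑F (λ k → φq (L k)) + (+ 1 + φq (P̂ x₁ · P̂ x₂))) (∑F-const (+ 1)) ⟩
            q * + 1 + ∑F (λ k → φq (L k)) + (+ 1 + φq (P̂ x₁ · P̂ x₂))  ≡⟨ regroup q _ _ ⟩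
            q + + 1 + G x₁ x₂                                           ∎
            where
              L : Carrier → Carrier
              L k = (P̂ x₁ · k +ᶠ Q̂ x₁) · (P̂ x₂ · k +ᶠ Q̂ x₂)
              regroup : ∀ q s t → q * + 1 + s + (+ 1 + t) ≡ q + + 1 + (s + t)
              regroup = solve-∀
          q[q[q+1]]≡q³+q² : ∀ q → q * (q * (q + + 1)) ≡ q * (q * (q * + 1)) + q * (q * + 1)
          q[q[q+1]]≡q³+q² = solve-∀

      M̃₂≡moment : M̃₂ F P Q ≡ moment
      M̃₂≡moment = begin
        ∑F (λ k → a F P Q k * a F P Q k) + a∞ F P * a∞ F P
          ≡⟨ cong₂ _+_ (∑-cong elems (λ k → trans (cong₂ _*_ (a≡ k) (a≡ k)) ([-∑φq]²≡∑∑φq (L k))))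
                       (trans (cong₂ _*_ a∞≡ a∞≡) ([-∑φq]²≡∑∑φq P̂)) ⟩
        ∑F (λ k → ∑∑ (λ x₁ x₂ → φq (L k x₁ · L k x₂))) + ∑∑ (λ x₁ x₂ → φq (P̂ x₁ · P̂ x₂))
          ≡⟨ cong (_+ ∑∑ (λ x₁ x₂ → φq (P̂ x₁ · P̂ x₂)))
               (trans (∑-comm elems elems _) (∑-cong elems (λ x₁ → ∑-comm elems elems _))) ⟩
        ∑∑ (λ x₁ x₂ → ∑F (λ k → φq (L k x₁ · L k x₂))) + ∑∑ (λ x₁ x₂ → φq (P̂ x₁ · P̂ x₂))
          ≡⟨ ∑∑-+ _ _ ⟨
        moment
          ∎
        where
          L : Carrier → Carrier → Carrier
          L k x = P̂ x · k +ᶠ Q̂ x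
          a≡ : ∀ k → a F P Q k ≡ - ∑F (λ x → φq (L k x))
          a≡ k = trans (cong (_-_ q) (trans (length-filter _ (pairs F)) (∑-pairs _))) (q-#[y²≡f]≡-∑φq (L k))
          a∞≡ : a∞ F P ≡ - ∑F (λ x → φq (P̂ x))
          a∞≡ = trans (cong (_-_ q) (trans (length-filter _ (pairs F)) (∑-pairs _))) (q-#[y²≡f]≡-∑φq P̂)

      #C-#Δ≡∑∑𝟙Δφq : + #C F P Q - + #Δ F P Q ≡ ∑∑ (λ x₁ x₂ → 𝟙Δ x₁ x₂ * φq (P̂ x₁ · P̂ x₂))
      #C-#Δ≡∑∑𝟙Δφq = begin
        + #C F P Q - + #Δ F P Q    ≡⟨ cong₂ _-_ #C≡ #Δ≡ ⟩
        ∑∑ 𝟙Δ + ∑∑ (λ x₁ x₂ → 𝟙Δ x₁ x₂ * φq (P̂ x₁ · P̂ x₂)) - ∑∑ 𝟙Δ  ≡⟨ [d+s]-d≡s (∑∑ 𝟙Δ) _ ⟩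
        ∑∑ (λ x₁ x₂ → 𝟙Δ x₁ x₂ * φq (P̂ x₁ · P̂ x₂))                   ∎
        where
          [d+s]-d≡s : ∀ d s → d + s - d ≡ s
          [d+s]-d≡s = solve-∀
          #Δ≡ : + #Δ F P Q ≡ ∑∑ 𝟙Δ
          #Δ≡ = trans (length-filter _ (pairs F)) (∑-pairs _)
          #C≡ : + #C F P Q ≡ ∑∑ 𝟙Δ + ∑∑ (λ x₁ x₂ → 𝟙Δ x₁ x₂ * φq (P̂ x₁ · P̂ x₂))
          #C≡ = begin
            + #C F P Q                                                          ≡⟨ trans (length-filter _ (triples F)) (∑-triples _) ⟩
            ∑∑ (λ x₁ x₂ → ∑F (λ y → 𝟙 ((P̂ x₁ · P̂ x₂ ≟ y · y) ×-dec (Δ F P Q x₁ x₂ ≟ 0#))))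
                                                                                ≡⟨ ∑∑-cong (λ x₁ x₂ → ∑-cong elems (λ y → 𝟙-× (P̂ x₁ · P̂ x₂ ≟ y · y) (Δ F P Q x₁ x₂ ≟ 0#))) ⟩
            ∑∑ (λ x₁ x₂ → ∑F (λ y → 𝟙 (P̂ x₁ · P̂ x₂ ≟ y · y) * 𝟙Δ x₁ x₂))    ≡⟨ ∑∑-cong (λ x₁ x₂ → ∑-*ʳ elems _ _) ⟩
            ∑∑ (λ x₁ x₂ → #√ (P̂ x₁ · P̂ x₂) * 𝟙Δ x₁ x₂)                        ≡⟨ ∑∑-cong (λ x₁ x₂ → cong (_* 𝟙Δ x₁ x₂) (#√≡1+φq _)) ⟩
            ∑∑ (λ x₁ x₂ → (+ 1 + φq (P̂ x₁ · P̂ x₂)) * 𝟙Δ x₁ x₂)                 ≡⟨ ∑∑-cong (λ x₁ x₂ → [1+f]d≡d+df (φq (P̂ x₁ · P̂ x₂)) (𝟙Δ x₁ x₂)) ⟩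
            ∑∑ (λ x₁ x₂ → 𝟙Δ x₁ x₂ + 𝟙Δ x₁ x₂ * φq (P̂ x₁ · P̂ x₂))             ≡⟨ ∑∑-+ _ _ ⟩
            ∑∑ 𝟙Δ + ∑∑ (λ x₁ x₂ → 𝟙Δ x₁ x₂ * φq (P̂ x₁ · P̂ x₂))                 ∎
            where [1+f]d≡d+df : ∀ f d → (+ 1 + f) * d ≡ d + d * f
                  [1+f]d≡d+df = solve-∀

      s : Carrier → ℤ
      s x = 𝟙 (P̂ x ≟ 0#) * φq (Q̂ x)

      S²≡∑∑ss : S F P Q ^ 2 ≡ ∑∑ (λ x₁ x₂ → s x₁ * s x₂)
      S²≡∑∑ss = begin
        S F P Q * (S F P Q * + 1)    ≡⟨ cong (S F P Q *_) (ℤP.*-identityʳ _) ⟩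
        S F P Q * S F P Q            ≡⟨ cong₂ _*_ S≡∑s S≡∑s ⟩
        ∑F s * ∑F s                  ≡⟨ ∑-*-∑ elems elems s s ⟩
        ∑∑ (λ x₁ x₂ → s x₁ * s x₂)   ∎
        where S≡∑s : S F P Q ≡ ∑F s
              S≡∑s = ∑-filter (λ x → P̂ x ≟ 0#) elems (φq ∘ Q̂)

      moment≡q[-#Δ+#C+S²] : moment ≡ q * (- + #Δ F P Q + + #C F P Q + S F P Q ^ 2)
      moment≡q[-#Δ+#C+S²] = begin
        moment                                                            ≡⟨ ∑∑-cong (λ x₁ x₂ → ∑φq-product (P̂ x₁) (Q̂ x₁) (P̂ x₂) (Q̂ x₂)) ⟩
        ∑∑ (λ x₁ x₂ → q * (𝟙Δ x₁ x₂ * φq (P̂ x₁ · P̂ x₂) + s x₁ * s x₂))   ≡⟨ ∑∑-*ˡ q _ ⟩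
        q * ∑∑ (λ x₁ x₂ → 𝟙Δ x₁ x₂ * φq (P̂ x₁ · P̂ x₂) + s x₁ * s x₂)     ≡⟨ cong (q *_) (∑∑-+ _ _) ⟩
        q * (∑∑ (λ x₁ x₂ → 𝟙Δ x₁ x₂ * φq (P̂ x₁ · P̂ x₂)) + ∑∑ (λ x₁ x₂ → s x₁ * s x₂))
                                                                          ≡⟨ cong (q *_) (cong₂ _+_ (sym #C-#Δ≡∑∑𝟙Δφq) (sym S²≡∑∑ss)) ⟩
        q * (+ #C F P Q - + #Δ F P Q + S F P Q ^ 2)                       ≡⟨ cong (q *_) (c-d+s≡-d+c+s (+ #C F P Q) (+ #Δ F P Q) (S F P Q ^ 2)) ⟩
        q * (- + #Δ F P Q + + #C F P Q + S F P Q ^ 2)                     ∎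
        where c-d+s≡-d+c+s : ∀ c d s → c - d + s ≡ - d + c + s
              c-d+s≡-d+c+s = solve-∀

theorem2p3 : (F : FiniteField) → ¬ (2 ∣ FiniteField.order F) → (P Q : Poly3) →
    ((+ #M F P Q) ≡ ((+ FiniteField.order F) ^ 3) + ((+ FiniteField.order F) ^ 2)
        - ((+ FiniteField.order F) * (+ #Δ F P Q))
        + ((+ FiniteField.order F) * (+ #C F P Q))
        + ((+ FiniteField.order F) * (S F P Q ^ 2)))
    × (M̃₂ F P Q ≡ (+ FiniteField.order F)
        * ((- (+ #Δ F P Q)) + (+ #C F P Q) + (S F P Q ^ 2)))
theorem2p3 F odd P Q =
  trans #M≡q³+q²+moment (trans (cong (λ m → q ^ 3 + q ^ 2 + m) moment≡q[-#Δ+#C+S²]) (expand (q ^ 3) (q ^ 2) q _ _ _)) ,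
  trans M̃₂≡moment moment≡q[-#Δ+#C+S²]
  where
    open FiniteFieldTheory F
    open OddOrder odd
    open Counts P Q
    expand : ∀ q³ q² q d c s → q³ + q² + q * (- d + c + s) ≡ q³ + q² - q * d + q * c + q * s
    expand = solve-∀
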